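{- Let $n\ge 1$ and let $q$ be an arbitrary prime power. Let $m(n,q)$ denote the largest integer $m$ for which there exist affine subspaces $A_1,\dots,A_m$ and $B_1,\dots,B_m$ of an $n$-dimensional affine space over $\mathbb{F}_q$ such that $A_i\cap B_i=\emptyset$ for each $1\le i\le m$ and $A_i\cap B_j\neq\emptyset$ whenever $1\le i<j\le m$. Then $$m(n,q)=2\cdot\frac{q^n-1}{q-1}.$$
   Context: The $n$-dimensional affine space over $\mathbb{F}_q$ is identified with $\mathbb{F}_q^n$; an affine subspace is a set of the form $v+V$ with $v\in\mathbb{F}_q^n$ and $V$ a linear subspace of $\mathbb{F}_q^n$. -}

module Defs where

open import Level using (0ℓ)
open import Data.Nat using (ℕ; _≤_)
open import Data.Fin using (Fin)
import Data.Fin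
open import Data.Product using (Σ; ∃; _×_; _,_)
open import Relation.Nullary using (¬_)
open import Relation.Binary.PropositionalEquality using (_≡_)
import Relation.Binary.PropositionalEquality as ≡
open import Algebra.Bundles using (CommutativeRing)
open import Function.Bundles using (Inverse)

IsField : CommutativeRing 0ℓ 0ℓ → Set
IsField F = ¬ (1# ≈ 0#) × (∀ x → ¬ (x ≈ 0#) → ∃ λ y → (x * y) ≈ 1#)
  where open CommutativeRing F

HasCard : CommutativeRing 0ℓ 0ℓ → ℕ → Set
HasCard F q = Inverse (CommutativeRing.setoid F) (≡.setoid (Fin q))

module _ (F : CommutativeRing 0ℓ 0ℓ) where
  open CommutativeRing F renaming (Carrier to K)

  Pt : ℕ → Set
  Pt n = Fin n → K

  _≋_ : ∀ {n} → Pt n → Pt n → Set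
  x ≋ y = ∀ i → x i ≈ y i

  record IsLinearSubspace {n : ℕ} (V : Pt n → Set) : Set where
    field
      resp   : ∀ {x y} → x ≋ y → V x → V y
      zero∈  : V (λ _ → 0#)
      +-closed : ∀ {x y} → V x → V y → V (λ i → x i + y i)
      *-closed : ∀ (c : K) {x} → V x → V (λ i → c * x i)

  IsAffineSubspace : ∀ {n} → (Pt n → Set) → Set₁
  IsAffineSubspace {n} A =
    Σ (Pt n) λ v → Σ (Pt n → Set) λ V → IsLinearSubspace V ×
      (∀ x → (A x → V (λ i → x i - v i)) × (V (λ i → x i - v i) → A x))

  Realizable : ℕ → ℕ → Set₁
  Realizable n m =
    Σ (Fin m → Pt n → Set) λ A → Σ (Fin m → Pt n → Set) λ B →
      (∀ i → IsAffineSubspace (A i)) × (∀ i → IsAffineSubspace (B i)) ×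
      (∀ i → ¬ (∃ λ x → A i x × B i x)) ×
      (∀ i j → Data.Fin._<_ i j → ∃ λ x → A i x × B j x)

  IsMaxRealizable : ℕ → ℕ → Set₁
  IsMaxRealizable n M = Realizable n M × (∀ m → Realizable n m → m ≤ M)

{-# OPTIONS --safe #-}
-- Disjoint affine subspaces v + V and w + W lie in distinct parallel hyperplanes: as
-- w - v ∉ V + W, some linear functional h vanishes on V + W but not at w - v, so h takes two
-- different constant values on them. Up to a nonzero scalar h is one of the (qⁿ - 1)/(q - 1)
-- points of projective space. If one direction h served three pairs i < j < k, the conditions
-- Aᵢ ∩ Bⱼ, Aᵢ ∩ Bₖ, Aⱼ ∩ Bₖ ≠ ∅ would give h(Aⱼ) = h(Bₖ) = h(Aᵢ) = h(Bⱼ), contradicting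
-- Aⱼ ∩ Bⱼ = ∅; so each direction serves at most two pairs. Conversely, the pairs
-- ({h = 0}, {h = 1}) and ({h = 1}, {h = 0}) over all directions h satisfy the conditions.
-- The functional h is only found under double negation, as subspaces are arbitrary predicates;
-- this suffices because the bound on m is decidable.
module Submission where

open import Defs using (IsField; HasCard; Pt; IsLinearSubspace; IsAffineSubspace; Realizable; IsMaxRealizable)
open import Level using (0ℓ)
open import Data.Empty using (⊥)
open import Data.Nat as ℕ using (ℕ; zero; suc; _∸_; _^_; _≤?_)
open import Data.Fin as Fin
  using (Fin; zero; suc; combine; remQuot; splitAt; join; _↑ˡ_; _↑ʳ_; finToFun; funToFin; opposite)
open import Data.Fin.Properties
  using (_≟_; <-cmp; <-trans; <⇒≢; any?; injective⇒≤; combine-injective; combine-remQuot; join-splitAt;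
         splitAt-↑ˡ; splitAt-↑ʳ; funToFin-finToFin; finToFun-funToFin; ¬∀⟶∃¬; sequence)
open import Data.Product using (∃; ∃₂; _×_; _,_; proj₁; proj₂)
open import Data.Sum using (_⊎_; inj₁; inj₂)
open import Data.Vec.Functional using (_∷_; tail)
open import Effect.Monad using (RawMonad)
open import Function using (_∘_)
open import Function.Bundles using (Inverse)
open import Function.Properties.Inverse using (Inverse⇒Injection)
open import Relation.Binary using (Decidable; tri<; tri≈; tri>)
open import Relation.Binary.PropositionalEquality as ≡ using (_≡_; _≢_)
open import Relation.Nullary using (¬_; Dec; yes; no; contradiction)
open import Relation.Nullary.Decidable using (_×-dec_; decidable-stable; ¬¬-excluded-middle; via-injection)
open import Relation.Nullary.Negation using (¬¬-Monad; ¬¬-map)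
open import Algebra.Bundles using (CommutativeRing)

open RawMonad (¬¬-Monad {0ℓ}) using (pure; _>>=_)

module _ where
  open import Data.Nat using (_+_; _*_)
  open import Data.Nat.Properties using (*-zeroʳ; *-comm; *-assoc; *-distribʳ-+; +-comm; +-∸-assoc; m^n>0)

  projectivePointCount : ℕ → ℕ → ℕ
  projectivePointCount q zero    = 0
  projectivePointCount q (suc n) = q ^ n + projectivePointCount q n

  projectivePointCount-*-∸1 : ∀ q n → projectivePointCount q n * (q ∸ 1) ≡ q ^ n ∸ 1
  projectivePointCount-*-∸1 zero    zero    = ≡.refl
  projectivePointCount-*-∸1 zero    (suc n) = *-zeroʳ (projectivePointCount zero (suc n))
  projectivePointCount-*-∸1 (suc r) zero    = ≡.refl
  projectivePointCount-*-∸1 (suc r) (suc n) = begin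
    (p + N) * r         ≡⟨ *-distribʳ-+ r p N ⟩
    p * r + N * r       ≡⟨ ≡.cong (p * r +_) (projectivePointCount-*-∸1 (suc r) n) ⟩
    p * r + (p ∸ 1)     ≡⟨ +-∸-assoc (p * r) (m^n>0 (suc r) n) ⟨
    p * r + p ∸ 1       ≡⟨ ≡.cong (_∸ 1) (+-comm (p * r) p) ⟩
    p + p * r ∸ 1       ≡⟨ ≡.cong (λ k → p + k ∸ 1) (*-comm p r) ⟩
    suc r * p ∸ 1       ∎
    where
    open ≡.≡-Reasoning
    p N : ℕ
    p = suc r ^ n
    N = projectivePointCount (suc r) n

  projectivePointCount-*2-*-∸1 : ∀ q n → projectivePointCount q n * 2 * (q ∸ 1) ≡ 2 * (q ^ n ∸ 1)
  projectivePointCount-*2-*-∸1 q n = begin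
    N * 2 * (q ∸ 1)   ≡⟨ ≡.cong (_* (q ∸ 1)) (*-comm N 2) ⟩
    2 * N * (q ∸ 1)   ≡⟨ *-assoc 2 N (q ∸ 1) ⟩
    2 * (N * (q ∸ 1)) ≡⟨ ≡.cong (2 *_) (projectivePointCount-*-∸1 q n) ⟩
    2 * (q ^ n ∸ 1)   ∎
    where
    open ≡.≡-Reasoning
    N : ℕ
    N = projectivePointCount q n

funToFin-cong : ∀ {m n} {f g : Fin m → Fin n} → (∀ i → f i ≡ g i) → funToFin f ≡ funToFin g
funToFin-cong {zero}  f≗g = ≡.refl
funToFin-cong {suc m} f≗g = ≡.cong₂ combine (f≗g zero) (funToFin-cong (f≗g ∘ suc))

splitAt-injective : ∀ m {n} {i j : Fin (m ℕ.+ n)} → splitAt m i ≡ splitAt m j → i ≡ j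
splitAt-injective m {n} {i} {j} eq =
  ≡.trans (≡.sym (join-splitAt m n i)) (≡.trans (≡.cong (join m n) eq) (join-splitAt m n j))

remQuot-injective : ∀ m {n} {i j : Fin (m ℕ.* n)} →
  proj₁ (remQuot {m} n i) ≡ proj₁ (remQuot {m} n j) →
  proj₂ (remQuot {m} n i) ≡ proj₂ (remQuot {m} n j) → i ≡ j
remQuot-injective m {n} {i} {j} eq₁ eq₂ =
  ≡.trans (≡.sym (combine-remQuot {m} n i))
          (≡.trans (≡.cong₂ combine eq₁ eq₂) (combine-remQuot {m} n j))

≢⇒≡opposite : ∀ {b b′ : Fin 2} → b ≢ b′ → b ≡ opposite b′
≢⇒≡opposite {zero}       {zero}       b≢b′ = contradiction ≡.refl b≢b′
≢⇒≡opposite {zero}       {suc zero}   _    = ≡.refl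
≢⇒≡opposite {suc zero}   {zero}       _    = ≡.refl
≢⇒≡opposite {suc zero}   {suc zero}   b≢b′ = contradiction ≡.refl b≢b′

no-triple-in-fibre⇒≤*2 : ∀ {m M} (g : Fin m → Fin M) →
  (∀ {i j k} → i Fin.< j → j Fin.< k → g i ≡ g j → g j ≡ g k → ⊥) → m ℕ.≤ M ℕ.* 2
no-triple-in-fibre⇒≤*2 {m} {M} g no-triple = injective⇒≤ tagged-injective
  where
  HasEarlierTwin : Fin m → Set
  HasEarlierTwin j = ∃ λ i → i Fin.< j × g i ≡ g j

  earlierTwin? : ∀ j → Dec (HasEarlierTwin j)
  earlierTwin? j = any? (λ i → (i Fin.<? j) ×-dec (g i ≟ g j))

  bit : ∀ {A : Set} → Dec A → Fin 2
  bit (yes _) = suc zero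
  bit (no _)  = zero

  bit-transfer : ∀ {A B : Set} (a? : Dec A) (b? : Dec B) → bit a? ≡ bit b? → B → A
  bit-transfer (yes a) _        _  _ = a
  bit-transfer (no _)  (yes _)  () _
  bit-transfer (no _)  (no ¬b)  _  b = contradiction b ¬b

  -- In a fibre with at most two elements the earlier one is tagged 0 and the later one 1.
  tagged : Fin m → Fin (M ℕ.* 2)
  tagged j = combine (g j) (bit (earlierTwin? j))

  ordered-distinct : ∀ {i j} → i Fin.< j → tagged i ≢ tagged j
  ordered-distinct {i} {j} i<j eq with combine-injective (g i) _ (g j) _ eq
  ... | gi≡gj , bits≡ with bit-transfer (earlierTwin? i) (earlierTwin? j) bits≡ (i , i<j , gi≡gj)
  ... | k , k<i , gk≡gi = no-triple k<i i<j gk≡gi gi≡gj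

  tagged-injective : ∀ {i j} → tagged i ≡ tagged j → i ≡ j
  tagged-injective {i} {j} eq with <-cmp i j
  ... | tri< i<j _ _ = contradiction eq (ordered-distinct i<j)
  ... | tri≈ _ i≡j _ = i≡j
  ... | tri> _ _ j<i = contradiction (≡.sym eq) (ordered-distinct j<i)

module LinearAlgebra (F : CommutativeRing 0ℓ 0ℓ) where
  open CommutativeRing F hiding (zero) renaming (Carrier to K)
  open import Algebra.Properties.Ring ring
    using (-1*x≈-x; -‿distribˡ-*; x∙y⁻¹≈ε⇒x≈y; x≈y⇒x∙y⁻¹≈ε; ⁻¹-anti-homo‿-; xyx⁻¹≈y;
           //-rightDividesˡ; //-rightDividesʳ)
  open import Algebra.Properties.CommutativeSemigroup +-commutativeSemigroup using (interchange)
  open import Algebra.Properties.CommutativeSemigroup *-commutativeSemigroup using (x∙yz≈y∙xz)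
  open import Algebra.Properties.Semiring.Sum semiring
    using (sum; sum-cong-≋; ∑-distrib-+; *-distribˡ-sum; sum-replicate-zero)
  open import Data.Vec.Functional.Relation.Binary.Equality.Setoid setoid
    using (_≋_; ≋-refl; ≋-sym; ≋-trans; ≋-reflexive)
  open import Relation.Binary.Reasoning.Setoid setoid
  open IsLinearSubspace

  𝟎 : ∀ {n} → Pt F n
  𝟎 _ = 0#

  infix 7 _·_
  _·_ : ∀ {n} → Pt F n → Pt F n → K
  f · x = sum (λ i → f i * x i)

  ·-cong : ∀ {n} {f f′ x x′ : Pt F n} → f ≋ f′ → x ≋ x′ → f · x ≈ f′ · x′
  ·-cong f≋f′ x≋x′ = sum-cong-≋ (λ i → *-cong (f≋f′ i) (x≋x′ i))

  ·-zeroˡ : ∀ {n} (x : Pt F n) → 𝟎 · x ≈ 0#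
  ·-zeroˡ {n} x = trans (sum-cong-≋ (λ i → zeroˡ (x i))) (sum-replicate-zero n)

  ·-zeroʳ : ∀ {n} (f : Pt F n) → f · 𝟎 ≈ 0#
  ·-zeroʳ {n} f = trans (sum-cong-≋ (λ i → zeroʳ (f i))) (sum-replicate-zero n)

  ·-distribˡ-+ : ∀ {n} (f x y : Pt F n) → f · (λ i → x i + y i) ≈ f · x + f · y
  ·-distribˡ-+ f x y = trans (sum-cong-≋ (λ i → distribˡ (f i) (x i) (y i)))
                             (∑-distrib-+ (λ i → f i * x i) (λ i → f i * y i))

  ·-scaleˡ : ∀ {n} c (f x : Pt F n) → (λ i → c * f i) · x ≈ c * (f · x)
  ·-scaleˡ c f x =
    trans (sum-cong-≋ (λ i → *-assoc c (f i) (x i))) (sym (*-distribˡ-sum c (λ i → f i * x i)))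

  ·-scaleʳ : ∀ {n} c (f x : Pt F n) → f · (λ i → c * x i) ≈ c * (f · x)
  ·-scaleʳ c f x =
    trans (sum-cong-≋ (λ i → x∙yz≈y∙xz (f i) c (x i))) (sym (*-distribˡ-sum c (λ i → f i * x i)))

  ·-distribˡ-sub : ∀ {n} (f x y : Pt F n) → f · (λ i → x i - y i) ≈ f · x - f · y
  ·-distribˡ-sub f x y = begin
    f · (λ i → x i - y i)          ≈⟨ ·-distribˡ-+ f x (λ i → - y i) ⟩
    f · x + f · (λ i → - y i)      ≈⟨ +-congˡ (·-cong ≋-refl (λ i → -1*x≈-x (y i))) ⟨
    f · x + f · (λ i → - 1# * y i) ≈⟨ +-congˡ (·-scaleʳ (- 1#) f y) ⟩
    f · x + - 1# * (f · y)         ≈⟨ +-congˡ (-1*x≈-x (f · y)) ⟩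
    f · x - f · y                  ∎

  ·-comm : ∀ {n} (f x : Pt F n) → f · x ≈ x · f
  ·-comm f x = sum-cong-≋ (λ i → *-comm (f i) (x i))

  ·-distribʳ-sub : ∀ {n} (f g x : Pt F n) → (λ i → f i - g i) · x ≈ f · x - g · x
  ·-distribʳ-sub f g x = begin
    (λ i → f i - g i) · x   ≈⟨ ·-comm _ x ⟩
    x · (λ i → f i - g i)   ≈⟨ ·-distribˡ-sub x f g ⟩
    x · f - x · g           ≈⟨ +-cong (·-comm x f) (-‿cong (·-comm x g)) ⟩
    f · x - g · x           ∎

  ·-sub≈0⇒≈ : ∀ {n} (h x y : Pt F n) → h · (λ i → x i - y i) ≈ 0# → h · x ≈ h · y
  ·-sub≈0⇒≈ h x y hx-hy≈0 = x∙y⁻¹≈ε⇒x≈y _ _ (trans (sym (·-distribˡ-sub h x y)) hx-hy≈0)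

  ≈⇒·-sub≈0 : ∀ {n} (h x y : Pt F n) → h · x ≈ h · y → h · (λ i → x i - y i) ≈ 0#
  ≈⇒·-sub≈0 h x y hx≈hy = trans (·-distribˡ-sub h x y) (x≈y⇒x∙y⁻¹≈ε hx≈hy)

  ·-0∷ˡ : ∀ {n} (f : Pt F n) (x : Pt F (suc n)) → (0# ∷ f) · x ≈ f · tail x
  ·-0∷ˡ f x = trans (+-congʳ (zeroˡ (x zero))) (+-identityˡ _)

  ·-0∷ʳ : ∀ {n} (f : Pt F (suc n)) (x : Pt F n) → f · (0# ∷ x) ≈ tail f · x
  ·-0∷ʳ f x = trans (+-congʳ (zeroʳ (f zero))) (+-identityˡ _)

  ·-1∷ : ∀ {n} (g x : Pt F n) α → (1# ∷ g) · (α ∷ x) ≈ α + g · x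
  ·-1∷ g x α = +-congʳ (*-identityˡ α)

  ·-1∷𝟎 : ∀ {n} (x : Pt F (suc n)) → (1# ∷ 𝟎) · x ≈ x zero
  ·-1∷𝟎 x = trans (+-cong (*-identityˡ (x zero)) (·-zeroˡ (tail x))) (+-identityʳ (x zero))

  head≈0⇒≋0∷tail : ∀ {n} {x : Pt F (suc n)} → x zero ≈ 0# → x ≋ 0# ∷ tail x
  head≈0⇒≋0∷tail x₀≈0 zero    = x₀≈0
  head≈0⇒≋0∷tail x₀≈0 (suc i) = refl

  kernel-linear : ∀ {n} (h : Pt F n) → IsLinearSubspace F (λ x → h · x ≈ 0#)
  kernel-linear h = record
    { resp     = λ x≋y hx≈0 → trans (·-cong ≋-refl (≋-sym x≋y)) hx≈0
    ; zero∈    = ·-zeroʳ h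
    ; +-closed = λ {x} {y} hx≈0 hy≈0 →
        trans (·-distribˡ-+ h x y) (trans (+-cong hx≈0 hy≈0) (+-identityʳ 0#))
    ; *-closed = λ c {x} hx≈0 → trans (·-scaleʳ c h x) (trans (*-congˡ hx≈0) (zeroʳ c))
    }

  levelSet-affine : ∀ {n} (h x₀ : Pt F n) {a} → h · x₀ ≈ a →
                    IsAffineSubspace F (λ x → h · x ≈ a)
  levelSet-affine h x₀ hx₀≈a = x₀ , (λ y → h · y ≈ 0#) , kernel-linear h , λ x →
    (λ hx≈a → ≈⇒·-sub≈0 h x x₀ (trans hx≈a (sym hx₀≈a))) ,
    (λ h[x-x₀]≈0 → trans (·-sub≈0⇒≈ h x x₀ h[x-x₀]≈0) hx₀≈a)

  sub-closed : ∀ {n} {U : Pt F n → Set} → IsLinearSubspace F U →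
               ∀ {x y} → U x → U y → U (λ i → x i - y i)
  sub-closed L x∈U y∈U = +-closed L x∈U (resp L (λ i → -1*x≈-x _) (*-closed L (- 1#) y∈U))

  tail-linear : ∀ {n} {U : Pt F (suc n) → Set} →
                IsLinearSubspace F U → IsLinearSubspace F (λ x → U (0# ∷ x))
  tail-linear L = record
    { resp     = λ x≋y → resp L (λ { zero → refl ; (suc i) → x≋y i })
    ; zero∈    = resp L (λ { zero → refl ; (suc i) → refl }) (zero∈ L)
    ; +-closed = λ x∈U y∈U →
        resp L (λ { zero → +-identityʳ 0# ; (suc i) → refl }) (+-closed L x∈U y∈U)
    ; *-closed = λ c x∈U → resp L (λ { zero → zeroʳ c ; (suc i) → refl }) (*-closed L c x∈U)
    }

  _+ₛ_ : ∀ {n} → (Pt F n → Set) → (Pt F n → Set) → Pt F n → Set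
  (V +ₛ W) x = ∃₂ λ y z → V y × W z × x ≋ (λ i → y i + z i)

  +ₛ-linear : ∀ {n} {V W : Pt F n → Set} →
              IsLinearSubspace F V → IsLinearSubspace F W → IsLinearSubspace F (V +ₛ W)
  +ₛ-linear LV LW = record
    { resp     = λ { x≋x′ (y , z , y∈V , z∈W , x≋y+z) →
        y , z , y∈V , z∈W , λ i → trans (sym (x≋x′ i)) (x≋y+z i) }
    ; zero∈    = 𝟎 , 𝟎 , zero∈ LV , zero∈ LW , λ i → sym (+-identityʳ 0#)
    ; +-closed = λ { (y , z , y∈V , z∈W , x≋y+z) (y′ , z′ , y′∈V , z′∈W , x′≋y′+z′) →
        _ , _ , +-closed LV y∈V y′∈V , +-closed LW z∈W z′∈W ,
        λ i → trans (+-cong (x≋y+z i) (x′≋y′+z′ i)) (interchange _ _ _ _) }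
    ; *-closed = λ { c (y , z , y∈V , z∈W , x≋y+z) →
        _ , _ , *-closed LV c y∈V , *-closed LW c z∈W ,
        λ i → trans (*-congˡ (x≋y+z i)) (distribˡ c _ _) }
    }

  disjoint-cosets⇒∉+ₛ : ∀ {n} {A B V W : Pt F n → Set} (v w : Pt F n) →
    IsLinearSubspace F V → IsLinearSubspace F W →
    (∀ x → V (λ i → x i - v i) → A x) → (∀ x → W (λ i → x i - w i) → B x) →
    ¬ (∃ λ x → A x × B x) → ¬ (V +ₛ W) (λ i → w i - v i)
  disjoint-cosets⇒∉+ₛ {n} {V = V} {W} v w LV LW v+V⊆A w+W⊆B A∩B≡∅
    (y , z , y∈V , z∈W , w-v≋y+z) =
    A∩B≡∅ (p , v+V⊆A p p-v∈V , w+W⊆B p p-w∈W)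
    where
    shift : ∀ {a b c d} → a - b ≈ c + d → (a - d) - b ≈ c
    shift {a} {b} {c} {d} a-b≈c+d = begin
      (a - d) - b   ≈⟨ +-assoc a (- d) (- b) ⟩
      a + (- d - b) ≈⟨ +-congˡ (+-comm (- d) (- b)) ⟩
      a + (- b - d) ≈⟨ +-assoc a (- b) (- d) ⟨
      (a - b) - d   ≈⟨ +-congʳ a-b≈c+d ⟩
      (c + d) - d   ≈⟨ //-rightDividesʳ d c ⟩
      c             ∎

    p : Pt F n
    p i = w i - z i

    p-v∈V : V (λ i → p i - v i)
    p-v∈V = resp LV (λ i → sym (shift (w-v≋y+z i))) y∈V

    p-w∈W : W (λ i → p i - w i)
    p-w∈W = resp LW (λ i → trans (-1*x≈-x (z i)) (sym (xyx⁻¹≈y (w i) (- z i))))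
                    (*-closed LW (- 1#) z∈W)

  record Separation {n} (h : Pt F n) (A B : Pt F n → Set) : Set where
    field
      valueA valueB : K
      distinct      : valueA ≉ valueB
      onA           : ∀ {x} → A x → h · x ≈ valueA
      onB           : ∀ {x} → B x → h · x ≈ valueB

  open Separation

  no-separated-triple : ∀ {n} {h : Pt F n} {A₁ B₁ A₂ B₂ A₃ B₃} →
    Separation h A₁ B₁ → Separation h A₂ B₂ → Separation h A₃ B₃ →
    (∃ λ x → A₁ x × B₂ x) → (∃ λ x → A₁ x × B₃ x) → (∃ λ x → A₂ x × B₃ x) → ⊥
  no-separated-triple σ₁ σ₂ σ₃ (_ , x₁₂∈A₁ , x₁₂∈B₂) (_ , x₁₃∈A₁ , x₁₃∈B₃) (_ , x₂₃∈A₂ , x₂₃∈B₃) =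
    distinct σ₂ (begin
      valueA σ₂   ≈⟨ meet σ₂ σ₃ x₂₃∈A₂ x₂₃∈B₃ ⟩
      valueB σ₃   ≈⟨ meet σ₁ σ₃ x₁₃∈A₁ x₁₃∈B₃ ⟨
      valueA σ₁   ≈⟨ meet σ₁ σ₂ x₁₂∈A₁ x₁₂∈B₂ ⟩
      valueB σ₂   ∎)
    where
    meet : ∀ {A B A′ B′ x} (σ : Separation _ A B) (τ : Separation _ A′ B′) →
           A x → B′ x → valueA σ ≈ valueB τ
    meet σ τ x∈A x∈B′ = trans (sym (onA σ x∈A)) (onB τ x∈B′)

  Onto : ∀ {n} → Pt F n → Set
  Onto h = ∀ a → ∃ λ x → h · x ≈ a

  JointlyOnto : ∀ {n} → Pt F n → Pt F n → Set
  JointlyOnto h h′ = ∀ a b → ∃ λ x → h · x ≈ a × h′ · x ≈ b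

  jointlyOnto-sym : ∀ {n} {h h′ : Pt F n} → JointlyOnto h h′ → JointlyOnto h′ h
  jointlyOnto-sym onto₂ a b with onto₂ b a
  ... | x , hx≈b , h′x≈a = x , h′x≈a , hx≈b

  jointlyOnto-0∷ : ∀ {n} {h h′ : Pt F n} → JointlyOnto h h′ → JointlyOnto (0# ∷ h) (0# ∷ h′)
  jointlyOnto-0∷ {h = h} {h′} onto₂ a b with onto₂ a b
  ... | x , hx≈a , h′x≈b =
    0# ∷ x , trans (·-0∷ˡ h (0# ∷ x)) hx≈a , trans (·-0∷ˡ h′ (0# ∷ x)) h′x≈b

  ·-1∷-solve : ∀ {n} (g x : Pt F n) a → (1# ∷ g) · ((a - g · x) ∷ x) ≈ a
  ·-1∷-solve g x a = trans (·-1∷ g x _) (//-rightDividesˡ (g · x) a)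

  jointlyOnto-1∷-0∷ : ∀ {n} (g : Pt F n) {h} → Onto h → JointlyOnto (1# ∷ g) (0# ∷ h)
  jointlyOnto-1∷-0∷ g {h} onto a b with onto b
  ... | x , hx≈b = (a - g · x) ∷ x , ·-1∷-solve g x a , trans (·-0∷ˡ h ((a - g · x) ∷ x)) hx≈b

  module Field (isField : IsField F) where

    1≉0 : 1# ≉ 0#
    1≉0 = proj₁ isField

    inverse : ∀ {x} → x ≉ 0# → ∃ λ y → x * y ≈ 1#
    inverse = proj₂ isField _

    *-cancelˡ : ∀ {s a b} → s ≉ 0# → s * a ≈ s * b → a ≈ b
    *-cancelˡ {s} {a} {b} s≉0 sa≈sb with inverse s≉0
    ... | t , st≈1 = begin
      a             ≈⟨ cancel a ⟨
      t * (s * a)   ≈⟨ *-congˡ sa≈sb ⟩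
      t * (s * b)   ≈⟨ cancel b ⟩
      b             ∎
      where
      cancel : ∀ x → t * (s * x) ≈ x
      cancel x =
        trans (sym (*-assoc t s x)) (trans (*-congʳ (trans (*-comm t s) st≈1)) (*-identityˡ x))

    Separation-scale : ∀ {n} {h h′ : Pt F n} {A B s} → s ≉ 0# → h′ ≋ (λ i → s * h i) →
                       Separation h A B → Separation h′ A B
    Separation-scale {h = h} {h′} {s = s} s≉0 h′≋sh σ = record
      { valueA   = s * valueA σ
      ; valueB   = s * valueB σ
      ; distinct = λ sa≈sb → distinct σ (*-cancelˡ s≉0 sa≈sb)
      ; onA      = λ x∈A → trans (scaled _) (*-congˡ (onA σ x∈A))
      ; onB      = λ x∈B → trans (scaled _) (*-congˡ (onB σ x∈B))
      }
      where
      scaled : ∀ x → h′ · x ≈ s * (h · x)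
      scaled x = trans (·-cong h′≋sh ≋-refl) (·-scaleˡ s h x)

    ·-onto : ∀ {n} (h : Pt F n) (d : Fin n) → h d ≉ 0# → Onto h
    ·-onto h zero h₀≉0 a with inverse h₀≉0
    ... | t , h₀t≈1 = t * a ∷ 𝟎 , (begin
      h zero * (t * a) + tail h · 𝟎   ≈⟨ +-cong (sym (*-assoc _ t a)) (·-zeroʳ (tail h)) ⟩
      h zero * t * a + 0#             ≈⟨ +-identityʳ _ ⟩
      h zero * t * a                  ≈⟨ *-congʳ h₀t≈1 ⟩
      1# * a                          ≈⟨ *-identityˡ a ⟩
      a                               ∎)
    ·-onto h (suc d) hd≉0 a with ·-onto (tail h) d hd≉0 a
    ... | x , hx≈a = 0# ∷ x , trans (·-0∷ʳ h x) hx≈a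

    jointlyOnto-1∷-1∷ : ∀ {n} (g g′ : Pt F n) d → g d ≉ g′ d → JointlyOnto (1# ∷ g) (1# ∷ g′)
    jointlyOnto-1∷-1∷ g g′ d gd≉g′d a b
      with ·-onto (λ i → g i - g′ i) d (gd≉g′d ∘ x∙y⁻¹≈ε⇒x≈y _ _) (a - b)
    ... | x , [g-g′]x≈a-b = (a - G) ∷ x , ·-1∷-solve g x a , (begin
      (1# ∷ g′) · ((a - G) ∷ x) ≈⟨ ·-1∷ g′ x (a - G) ⟩
      (a - G) + G′              ≈⟨ +-assoc a (- G) G′ ⟩
      a + (- G + G′)            ≈⟨ +-congˡ (+-comm (- G) G′) ⟩
      a + (G′ - G)              ≈⟨ +-congˡ (⁻¹-anti-homo‿- G G′) ⟨
      a - (G - G′)              ≈⟨ +-congˡ (-‿cong G-G′≈a-b) ⟩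
      a - (a - b)               ≈⟨ +-congˡ (⁻¹-anti-homo‿- a b) ⟩
      a + (b - a)               ≈⟨ +-assoc a b (- a) ⟨
      a + b - a                 ≈⟨ xyx⁻¹≈y a b ⟩
      b                         ∎)
      where
      G G′ : K
      G  = g · x
      G′ = g′ · x

      G-G′≈a-b : G - G′ ≈ a - b
      G-G′≈a-b = trans (sym (·-distribʳ-sub g g′ x)) [g-g′]x≈a-b

    module Separating (_≈?_ : Decidable _≈_) where

      SeparatingFunctional : ∀ {n} → (Pt F n → Set) → Pt F n → Set
      SeparatingFunctional U u = ∃ λ f → (∀ {x} → U x → f · x ≈ 0#) × f · u ≉ 0#

      SeparationProperty : ℕ → Set₁
      SeparationProperty n =
        ∀ {U : Pt F n → Set} → IsLinearSubspace F U → ∀ {u} → ¬ U u → ¬ ¬ SeparatingFunctional U u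

      -- Subtracting multiples of e projects U onto its intersection with the hyperplane x₀ = 0.
      separate-via-pivot : ∀ {n} → SeparationProperty n →
        ∀ {U : Pt F (suc n) → Set} → IsLinearSubspace F U → ∀ {e} → U e → e zero ≈ 1# →
        ∀ {u} → ¬ U u → ¬ ¬ SeparatingFunctional U u
      separate-via-pivot {n} separate′ {U} L {e} e∈U e₀≈1 {u} u∉U = do
          f , f⊥U′ , fπu≉0 ← separate′ (tail-linear L) (u∉U ∘ unproject)
          pure ((- (f · tail e)) ∷ f ,
                (λ {x} x∈U → trans (lift f x) (f⊥U′ (project x∈U))) ,
                λ fu≈0 → fπu≉0 (trans (sym (lift f u)) fu≈0))
        where
        π : Pt F (suc n) → Pt F (suc n)
        π x i = x i - x zero * e i

        π-head : ∀ x → π x zero ≈ 0#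
        π-head x = begin
          x zero - x zero * e zero ≈⟨ +-congˡ (-‿cong (trans (*-congˡ e₀≈1) (*-identityʳ _))) ⟩
          x zero - x zero          ≈⟨ -‿inverseʳ _ ⟩
          0#                       ∎

        project : ∀ {x} → U x → U (0# ∷ tail (π x))
        project {x} x∈U =
          resp L (head≈0⇒≋0∷tail (π-head x)) (sub-closed L x∈U (*-closed L (x zero) e∈U))

        unproject : U (0# ∷ tail (π u)) → U u
        unproject πu∈U = resp L (λ i → //-rightDividesˡ (u zero * e i) (u i))
          (+-closed L (resp L (≋-sym (head≈0⇒≋0∷tail (π-head u))) πu∈U)
                    (*-closed L (u zero) e∈U))

        lift : ∀ g x → ((- (g · tail e)) ∷ g) · x ≈ g · tail (π x)
        lift g x = begin
          - D * x zero + g · tail x      ≈⟨ +-congʳ (-‿distribˡ-* D (x zero)) ⟨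
          - (D * x zero) + g · tail x    ≈⟨ +-comm _ _ ⟩
          g · tail x - D * x zero        ≈⟨ +-congˡ (-‿cong (*-comm D (x zero))) ⟩
          g · tail x - x zero * D        ≈⟨ +-congˡ (-‿cong (·-scaleʳ (x zero) g (tail e))) ⟨
          g · tail x - g · x₀e           ≈⟨ ·-distribˡ-sub g (tail x) x₀e ⟨
          g · tail (π x)                 ∎
          where
          D : K
          D = g · tail e
          x₀e : Pt F n
          x₀e i = x zero * e (suc i)

      separate-in-hyperplane : ∀ {n} → SeparationProperty n →
        ∀ {U : Pt F (suc n) → Set} → IsLinearSubspace F U → (∀ {x} → U x → x zero ≈ 0#) →
        ∀ {u} → ¬ U u → ¬ ¬ SeparatingFunctional U u
      separate-in-hyperplane separate′ L U⊆x₀≈0 {u} u∉U with u zero ≈? 0#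
      ... | no u₀≉0 = pure (1# ∷ 𝟎 ,
                            (λ {x} x∈U → trans (·-1∷𝟎 x) (U⊆x₀≈0 x∈U)) ,
                            λ u₀≈0 → u₀≉0 (trans (sym (·-1∷𝟎 u)) u₀≈0))
      ... | yes u₀≈0 = do
          f , f⊥U′ , f[tail-u]≉0 ←
            separate′ (tail-linear L) (u∉U ∘ resp L (≋-sym (head≈0⇒≋0∷tail u₀≈0)))
          pure (0# ∷ f ,
                (λ {x} x∈U → trans (·-0∷ˡ f x)
                                   (f⊥U′ (resp L (head≈0⇒≋0∷tail (U⊆x₀≈0 x∈U)) x∈U))) ,
                λ fu≈0 → f[tail-u]≉0 (trans (sym (·-0∷ˡ f u)) fu≈0))

      separate : ∀ n → SeparationProperty n
      separate zero    L u∉U = contradiction (resp L (λ ()) (zero∈ L)) u∉U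
      separate (suc n) {U} L u∉U = ¬¬-excluded-middle {A = ∃ λ y → U y × y zero ≉ 0#} >>= λ where
        (yes (y , y∈U , y₀≉0)) → let t , y₀t≈1 = inverse y₀≉0 in
          separate-via-pivot (separate n) L (*-closed L t y∈U) (trans (*-comm t (y zero)) y₀t≈1) u∉U
        (no no-pivot) → separate-in-hyperplane (separate n) L
          (λ {x} x∈U → decidable-stable (x zero ≈? 0#) λ x₀≉0 → no-pivot (x , x∈U , x₀≉0)) u∉U

      disjoint⇒separated : ∀ {n} {A B : Pt F n → Set} →
        IsAffineSubspace F A → IsAffineSubspace F B → ¬ (∃ λ x → A x × B x) →
        ¬ ¬ (∃ λ h → ¬ (h ≋ 𝟎) × Separation h A B)
      disjoint⇒separated {n} {A} {B} (v , V , LV , A≡v+V) (w , W , LW , B≡w+W) A∩B≡∅ = do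
          h , h⊥V+W , h[w-v]≉0 ← separate n (+ₛ-linear LV LW)
            (disjoint-cosets⇒∉+ₛ v w LV LW (proj₂ ∘ A≡v+V) (proj₂ ∘ B≡w+W) A∩B≡∅)
          pure (h , (λ h≋0 → h[w-v]≉0 (trans (·-cong h≋0 ≋-refl) (·-zeroˡ (λ i → w i - v i)))) , record
            { valueA   = h · v
            ; valueB   = h · w
            ; distinct = λ hv≈hw → h[w-v]≉0 (≈⇒·-sub≈0 h w v (sym hv≈hw))
            ; onA      = λ {x} x∈A → ·-sub≈0⇒≈ h x v
                           (h⊥V+W (_ , 𝟎 , proj₁ (A≡v+V x) x∈A , zero∈ LW , λ i → sym (+-identityʳ _)))
            ; onB      = λ {x} x∈B → ·-sub≈0⇒≈ h x w
                           (h⊥V+W (𝟎 , _ , zero∈ LV , proj₁ (B≡w+W x) x∈B , λ i → sym (+-identityˡ _)))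
            })

    module Finite (q : ℕ) (card : HasCard F q) where
      open Inverse card using (to; from; to-cong; strictlyInverseˡ; strictlyInverseʳ)

      _≈?_ : Decidable _≈_
      _≈?_ = via-injection (Inverse⇒Injection card) _≟_

      open Separating _≈?_

      point : ∀ {n} → Fin (q ^ n) → Pt F n
      point t i = from (finToFun t i)

      index : ∀ {n} → Pt F n → Fin (q ^ n)
      index x = funToFin (λ i → to (x i))

      point-index : ∀ {n} (x : Pt F n) → point (index x) ≋ x
      point-index x i =
        trans (reflexive (≡.cong from (finToFun-funToFin (λ j → to (x j)) i))) (strictlyInverseʳ (x i))

      point-injective : ∀ {n} {t t′ : Fin (q ^ n)} → point t ≋ point t′ → t ≡ t′
      point-injective {n} {t} {t′} t≋t′ =
        ≡.trans (≡.sym (funToFin-finToFin {n} {q} t))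
                (≡.trans (funToFin-cong from-injective) (funToFin-finToFin {n} t′))
        where
        from-injective : ∀ i → finToFun {q} {n} t i ≡ finToFun t′ i
        from-injective i =
          ≡.trans (≡.sym (strictlyInverseˡ _)) (≡.trans (to-cong (t≋t′ i)) (strictlyInverseˡ _))

      -- One representative per point of projective (n - 1)-space: the vectors whose first nonzero
      -- coordinate is 1, those with x₀ = 1 (indexed by Fin (q ^ n)) listed before those with x₀ = 0.
      mutual
        projectivePoint : ∀ n → Fin (projectivePointCount q n) → Pt F n
        projectivePoint zero    ()
        projectivePoint (suc n) c = projectivePoint⊎ n (splitAt (q ^ n) c)

        projectivePoint⊎ : ∀ n → Fin (q ^ n) ⊎ Fin (projectivePointCount q n) → Pt F (suc n)
        projectivePoint⊎ n (inj₁ t) = 1# ∷ point t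
        projectivePoint⊎ n (inj₂ c) = 0# ∷ projectivePoint n c

      projectivePoint-↑ˡ : ∀ n t →
                           projectivePoint (suc n) (t ↑ˡ projectivePointCount q n) ≡ 1# ∷ point t
      projectivePoint-↑ˡ n t = ≡.cong (projectivePoint⊎ n) (splitAt-↑ˡ (q ^ n) t _)

      projectivePoint-↑ʳ : ∀ n c → projectivePoint (suc n) (q ^ n ↑ʳ c) ≡ 0# ∷ projectivePoint n c
      projectivePoint-↑ʳ n c = ≡.cong (projectivePoint⊎ n) (splitAt-↑ʳ (q ^ n) _ c)

      mutual
        projectivePoint-pivot : ∀ n c → ∃ λ d → projectivePoint n c d ≈ 1#
        projectivePoint-pivot (suc n) c = projectivePoint⊎-pivot n (splitAt (q ^ n) c)

        projectivePoint⊎-pivot : ∀ n s → ∃ λ d → projectivePoint⊎ n s d ≈ 1#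
        projectivePoint⊎-pivot n (inj₁ t) = zero , refl
        projectivePoint⊎-pivot n (inj₂ c) with projectivePoint-pivot n c
        ... | d , pd≈1 = suc d , pd≈1

      projectivePoint-onto : ∀ n c → Onto (projectivePoint n c)
      projectivePoint-onto n c with projectivePoint-pivot n c
      ... | d , pd≈1 = ·-onto (projectivePoint n c) d (λ pd≈0 → 1≉0 (trans (sym pd≈1) pd≈0))

      mutual
        projectivePoint-independent : ∀ n {c c′} → c ≢ c′ →
                                      JointlyOnto (projectivePoint n c) (projectivePoint n c′)
        projectivePoint-independent (suc n) c≢c′ =
          projectivePoint⊎-independent n (c≢c′ ∘ splitAt-injective (q ^ n))

        projectivePoint⊎-independent : ∀ n {s s′} → s ≢ s′ →
                                       JointlyOnto (projectivePoint⊎ n s) (projectivePoint⊎ n s′)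
        projectivePoint⊎-independent n {inj₁ t} {inj₁ t′} s≢s′
          with ¬∀⟶∃¬ n _ (λ i → point t i ≈? point t′ i) (s≢s′ ∘ ≡.cong inj₁ ∘ point-injective)
        ... | d , td≉t′d = jointlyOnto-1∷-1∷ (point t) (point t′) d td≉t′d
        projectivePoint⊎-independent n {inj₁ t} {inj₂ c′} _ =
          jointlyOnto-1∷-0∷ (point t) (projectivePoint-onto n c′)
        projectivePoint⊎-independent n {inj₂ c} {inj₁ t′} _ =
          jointlyOnto-sym {h = 1# ∷ point t′} {0# ∷ projectivePoint n c}
            (jointlyOnto-1∷-0∷ (point t′) (projectivePoint-onto n c))
        projectivePoint⊎-independent n {inj₂ c} {inj₂ c′} s≢s′ =
          jointlyOnto-0∷ (projectivePoint-independent n (s≢s′ ∘ ≡.cong inj₂))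

      projectivePoint-normalize : ∀ n (f : Pt F n) → ¬ (f ≋ 𝟎) →
                                  ∃₂ λ c s → s ≉ 0# × projectivePoint n c ≋ (λ i → s * f i)
      projectivePoint-normalize zero    f f≉0 = contradiction (λ ()) f≉0
      projectivePoint-normalize (suc n) f f≉0 with f zero ≈? 0#
      ... | yes f₀≈0
        with projectivePoint-normalize n (tail f) (λ tail≋0 → f≉0 λ { zero → f₀≈0 ; (suc i) → tail≋0 i })
      ...   | c , s , s≉0 , pc≋s·tail = q ^ n ↑ʳ c , s , s≉0 ,
                ≋-trans (≋-reflexive (projectivePoint-↑ʳ n c)) λ where
                  zero    → sym (trans (*-congˡ f₀≈0) (zeroʳ s))
                  (suc i) → pc≋s·tail i
      projectivePoint-normalize (suc n) f f≉0 | no f₀≉0 with inverse f₀≉0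
      ... | s , f₀s≈1 = index (λ i → s * f (suc i)) ↑ˡ _ , s , s≉0 ,
                        ≋-trans (≋-reflexive (projectivePoint-↑ˡ n _)) λ where
                          zero    → sym (trans (*-comm s (f zero)) f₀s≈1)
                          (suc i) → point-index (λ j → s * f (suc j)) i
        where
        s≉0 : s ≉ 0#
        s≉0 s≈0 = 1≉0 (trans (sym f₀s≈1) (trans (*-congˡ s≈0) (zeroʳ _)))

      disjoint⇒projectivelySeparated : ∀ {n} {A B : Pt F n → Set} →
        IsAffineSubspace F A → IsAffineSubspace F B → ¬ (∃ λ x → A x × B x) →
        ¬ ¬ (∃ λ c → Separation (projectivePoint n c) A B)
      disjoint⇒projectivelySeparated {n} A-affine B-affine A∩B≡∅ = do
        h , h≉0 , σ ← disjoint⇒separated A-affine B-affine A∩B≡∅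
        let c , s , s≉0 , pc≋sh = projectivePoint-normalize n h h≉0
        pure (c , Separation-scale s≉0 pc≋sh σ)

      realizable⇒≤ : ∀ {n m} → Realizable F n m → m ℕ.≤ projectivePointCount q n ℕ.* 2
      realizable⇒≤ {n} {m} (A , B , A-affine , B-affine , Aᵢ∩Bᵢ≡∅ , Aᵢ∩Bⱼ≢∅) =
        decidable-stable (m ≤? _) (¬¬-map separations⇒≤
          (sequence (RawMonad.rawApplicative ¬¬-Monad)
            (λ i → disjoint⇒projectivelySeparated (A-affine i) (B-affine i) (Aᵢ∩Bᵢ≡∅ i))))
        where
        separations⇒≤ : (∀ i → ∃ λ c → Separation (projectivePoint n c) (A i) (B i)) →
                        m ℕ.≤ projectivePointCount q n ℕ.* 2
        separations⇒≤ σ =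
          no-triple-in-fibre⇒≤*2 (proj₁ ∘ σ) λ {i} {j} {k} i<j j<k cᵢ≡cⱼ cⱼ≡cₖ →
            no-separated-triple (realign i cᵢ≡cⱼ) (proj₂ (σ j)) (realign k (≡.sym cⱼ≡cₖ))
              (Aᵢ∩Bⱼ≢∅ i j i<j) (Aᵢ∩Bⱼ≢∅ i k (<-trans i<j j<k)) (Aᵢ∩Bⱼ≢∅ j k j<k)
          where
          realign : ∀ i {c} → proj₁ (σ i) ≡ c → Separation (projectivePoint n c) (A i) (B i)
          realign i eq = ≡.subst (λ c → Separation (projectivePoint n c) (A i) (B i)) eq (proj₂ (σ i))

      level : Fin 2 → K
      level zero       = 0#
      level (suc zero) = 1#

      level≉level-opposite : ∀ b → level b ≉ level (opposite b)
      level≉level-opposite zero       = 1≉0 ∘ sym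
      level≉level-opposite (suc zero) = 1≉0

      realizable-lower : ∀ n → Realizable F n (projectivePointCount q n ℕ.* 2)
      realizable-lower n = A , B ,
        (λ i → levelSet-affine _ _ (proj₂ (projectivePoint-onto n (direction i) _))) ,
        (λ i → levelSet-affine _ _ (proj₂ (projectivePoint-onto n (direction i) _))) ,
        (λ i (x , x∈Aᵢ , x∈Bᵢ) → level≉level-opposite (side i) (trans (sym x∈Aᵢ) x∈Bᵢ)) ,
        (λ i j i<j → meet (<⇒≢ i<j))
        where
        N : ℕ
        N = projectivePointCount q n

        direction : Fin (N ℕ.* 2) → Fin N
        direction i = proj₁ (remQuot {N} 2 i)

        side : Fin (N ℕ.* 2) → Fin 2
        side i = proj₂ (remQuot {N} 2 i)

        A B : Fin (N ℕ.* 2) → Pt F n → Set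
        A i x = projectivePoint n (direction i) · x ≈ level (side i)
        B i x = projectivePoint n (direction i) · x ≈ level (opposite (side i))

        meet : ∀ {i j} → i ≢ j → ∃ λ x → A i x × B j x
        meet {i} {j} i≢j with direction i ≟ direction j
        ... | no  dᵢ≢dⱼ = projectivePoint-independent n dᵢ≢dⱼ _ _
        ... | yes dᵢ≡dⱼ with projectivePoint-onto n (direction i) (level (side i))
        ...   | x , x∈Aᵢ = x , x∈Aᵢ ,
                ≡.subst₂ (λ c b → projectivePoint n c · x ≈ level b)
                         dᵢ≡dⱼ (≢⇒≡opposite sᵢ≢sⱼ) x∈Aᵢ
          where
          sᵢ≢sⱼ : side i ≢ side j
          sᵢ≢sⱼ sᵢ≡sⱼ = i≢j (remQuot-injective N dᵢ≡dⱼ sᵢ≡sⱼ)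

open import Data.Nat using (_≥_; _*_)

theorem2p2 : (n : ℕ) → n ≥ 1 → (q : ℕ) → (F : CommutativeRing 0ℓ 0ℓ) →
    IsField F → HasCard F q →
    ∃ λ M → IsMaxRealizable F n M × M * (q ∸ 1) ≡ 2 * (q ^ n ∸ 1)
theorem2p2 n _ q F isField card =
  projectivePointCount q n * 2 ,
  (realizable-lower n , λ m → realizable⇒≤) ,
  projectivePointCount-*2-*-∸1 q n
  where open LinearAlgebra.Field.Finite F isField q card
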